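{- Let $\Gamma$ be a non-trivial strongly regular $n$-tricirculant with parameters $(3n,k,\lambda,\mu)$, where either $n$ is prime or $n$ is coprime to $6\sqrt{(\lambda-\mu)^2+4(k-\mu)}$, and let $\sigma$ be a $(3,n)$-semiregular automorphism of $\Gamma$. Assume that at least one edge of $\Gamma$ has both endvertices in the same orbit of $\sigma$, and that the number of edges of $\Gamma$ with both endvertices in the same orbit of $\sigma$ is at most the number of edges of the complement $\overline{\Gamma}$ with both endvertices in the same orbit of $\sigma$. Assume moreover that for some integer $s$, $$(3n,k,\lambda,\mu)=(3(3s^2-3s+1),\,s(3s-1),\,s^2+s-1,\,s^2).$$ Then no edge of $\Gamma$ is $3$-isoregular.
   Context: All graphs are finite and simple. A strongly regular graph with parameters $(N,k,\lambda,\mu)$ is a $k$-regular graph on $N$ vertices in which adjacent vertices have exactly $\lambda$ common neighbours and distinct non-adjacent vertices have exactly $\mu$ common neighbours; it is non-trivial if both it and its complement are connected. An $n$-tricirculant is a graph on $3n$ vertices admitting a $(3,n)$-semiregular automorphism, i.e. an automorphism whose cycle decomposition consists of exactly three cycles (orbits) of length $n$. For a vertex set $T$, the valency of $T$ is the number of vertices adjacent to every vertex of $T$. An ordered pair $(x,y)$ of adjacent vertices (an edge) is $3$-isoregular if for all vertices $z\ne x,y$ the valency of $\{x,y,z\}$ depends only on the isomorphism type of the subgraph induced on $\{x,y,z\}$. -}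

module Defs where

open import Data.Bool using (Bool; true; false; _∧_; not; if_then_else_)
open import Data.Nat using (ℕ; zero; suc; _+_; _*_; _<_)
open import Data.Fin using (Fin; zero; suc; toℕ; _≟_)
open import Data.Fin.Permutation using (Permutation′; _⟨$⟩ʳ_)
open import Data.Product using (Σ; ∃; _×_; _,_)
open import Relation.Binary.PropositionalEquality using (_≡_; _≢_)
open import Relation.Nullary using (¬_)
open import Relation.Nullary.Decidable using (⌊_⌋)

record Graph (N : ℕ) : Set where
  field
    adj     : Fin N → Fin N → Bool
    adj-sym : ∀ x y → adj x y ≡ adj y x
    adj-irr : ∀ x → adj x x ≡ false
open Graph public

count : ∀ {N} → (Fin N → Bool) → ℕ
count {zero}  f = 0
count {suc N} f = (if f zero then 1 else 0) + count (λ v → f (suc v))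

anyFin : ∀ {n} → (Fin n → Bool) → Bool
anyFin {zero}  f = false
anyFin {suc n} f = if f zero then true else anyFin (λ i → f (suc i))

_==_ : ∀ {N} → Fin N → Fin N → Bool
x == y = ⌊ x ≟ y ⌋

complement : ∀ {N} → Graph N → Graph N
complement {N} G = record
  { adj = λ x y → not (adj G x y) ∧ not (x == y)
  ; adj-sym = sym'
  ; adj-irr = irr' }
  where
  open import Relation.Binary.PropositionalEquality using (refl; cong₂; cong)
  open import Data.Bool.Properties using (∧-zeroʳ)
  sym' : ∀ x y → (not (adj G x y) ∧ not (x == y)) ≡ (not (adj G y x) ∧ not (y == x))
  sym' x y with x ≟ y | y ≟ x
  ... | Relation.Nullary.yes _ | Relation.Nullary.yes _ = cong (λ b → not b ∧ false) (adj-sym G x y)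
  ... | Relation.Nullary.yes refl | Relation.Nullary.no q with () ← q refl
  ... | Relation.Nullary.no p | Relation.Nullary.yes refl with () ← p refl
  ... | Relation.Nullary.no _ | Relation.Nullary.no _ = cong (λ b → not b ∧ true) (adj-sym G x y)
  irr' : ∀ x → (not (adj G x x) ∧ not (x == x)) ≡ false
  irr' x with x ≟ x
  ... | Relation.Nullary.yes _ = ∧-zeroʳ _
  ... | Relation.Nullary.no p with () ← p refl

degree : ∀ {N} → Graph N → Fin N → ℕ
degree G x = count (λ v → adj G x v)

commonNbrs : ∀ {N} → Graph N → Fin N → Fin N → ℕ
commonNbrs G x y = count (λ v → adj G x v ∧ adj G y v)

valency3 : ∀ {N} → Graph N → Fin N → Fin N → Fin N → ℕ
valency3 G x y z = count (λ v → adj G x v ∧ adj G y v ∧ adj G z v)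

IsSRG : ∀ {N} → Graph N → ℕ → ℕ → ℕ → Set
IsSRG G k l m =
  (∀ x → degree G x ≡ k) ×
  (∀ x y → x ≢ y → adj G x y ≡ true  → commonNbrs G x y ≡ l) ×
  (∀ x y → x ≢ y → adj G x y ≡ false → commonNbrs G x y ≡ m)

data Reach {N} (G : Graph N) (x : Fin N) : Fin N → Set where
  here : Reach G x x
  step : ∀ {y z} → Reach G x y → adj G y z ≡ true → Reach G x z

Connected : ∀ {N} → Graph N → Set
Connected G = ∀ x y → Reach G x y

NonTrivial : ∀ {N} → Graph N → Set
NonTrivial G = Connected G × Connected (complement G)

IsAutomorphism : ∀ {N} → Graph N → Permutation′ N → Set
IsAutomorphism G σ = ∀ x y → adj G (σ ⟨$⟩ʳ x) (σ ⟨$⟩ʳ y) ≡ adj G x y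

iter : ∀ {N} → Permutation′ N → ℕ → Fin N → Fin N
iter σ zero    x = x
iter σ (suc i) x = σ ⟨$⟩ʳ (iter σ i x)

-- (3,n)-semiregular on Fin (3 * n): every cycle of σ has length exactly n
-- (hence there are exactly 3 cycles, as the vertex set has 3n elements)
IsSemiregular3 : (n : ℕ) → Permutation′ (3 * n) → Set
IsSemiregular3 n σ =
  (∀ x → iter σ n x ≡ x) × (∀ x i → 0 < i → i < n → iter σ i x ≢ x)

sameOrbit : ∀ {N} → (n : ℕ) → Permutation′ N → Fin N → Fin N → Bool
sameOrbit n σ x y = anyFin {n} (λ i → iter σ (toℕ i) x == y)

edgesInOrbits : ∀ {N} → Graph N → (n : ℕ) → Permutation′ N → ℕ
edgesInOrbits G n σ =
  sumFin (λ x → count (λ y → ⌊ toℕ x Data.Nat.<? toℕ y ⌋ ∧ adj G x y ∧ sameOrbit n σ x y))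
  where
  import Data.Nat
  sumFin : ∀ {M} → (Fin M → ℕ) → ℕ
  sumFin {zero}  f = 0
  sumFin {suc M} f = f zero + sumFin (λ v → f (suc v))

triple : ∀ {N} → Fin N → Fin N → Fin N → Fin 3 → Fin N
triple x y z zero             = x
triple x y z (suc zero)       = y
triple x y z (suc (suc zero)) = z

InducedIso : ∀ {N} → Graph N → Fin N → Fin N → Fin N → Fin N → Set
InducedIso G x y z w = Σ (Permutation′ 3) λ π →
  ∀ i j → adj G (triple x y z i) (triple x y z j)
        ≡ adj G (triple x y w (π ⟨$⟩ʳ i)) (triple x y w (π ⟨$⟩ʳ j))

ThreeIsoregular : ∀ {N} → Graph N → Fin N → Fin N → Set
ThreeIsoregular G x y =
  adj G x y ≡ true ×
  (∀ z w → z ≢ x → z ≢ y → w ≢ x → w ≢ y →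
     InducedIso G x y z w → valency3 G x y z ≡ valency3 G x y w)

-- Fix an edge xy and sort the remaining vertices by their adjacency to x and y: the λ common
-- neighbours, the K₁ = k − λ − 1 neighbours of x other than y that are not adjacent to y, and
-- the K₀ vertices adjacent to neither. If xy is 3-isoregular, the valency of {x, y, z} takes
-- constant values α, β, γ on these three classes, and a common neighbour of x and y has the same
-- numbers p and q of neighbours in the second and third class, with p + q = K₁. Double counting
-- gives K₁β = λp and K₀γ = λq. On the family, K₁ = 2s(s − 1) and K₀ = 2(2s − 1)(s − 1), and
-- since λ is prime to K₁ and to 2s − 1 this forces β = λ, hence p = K₁ and λ = α + 1 + K₁.
-- That is impossible for |s| ≥ 2 except when s = 2 and α = 0, and then two non-adjacent common
-- neighbours of x and y would have more than μ common neighbours. For s ∈ {−1, 0} the value of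
-- λ is negative, and s = 1 (so n = 1) is ruled out by the edge inside an orbit of σ.
module Submission where

open import Defs
open import Data.Bool using (Bool; true; false; _∧_; not; if_then_else_)
open import Data.Bool.Properties using (∧-identityʳ; ∧-conicalˡ; ∧-conicalʳ; ∧-comm; ∧-assoc; not-injective; ∧-commutativeMonoid)
import Data.Bool.Properties as Bool
open import Algebra.Bundles using (CommutativeMonoid)
open import Algebra.Properties.CommutativeSemigroup (CommutativeMonoid.commutativeSemigroup ∧-commutativeMonoid)
  using (x∙yz≈y∙xz; xy∙z≈x∙zy; xy∙z≈xz∙y; xy∙z≈z∙yx; xy∙z≈yz∙x)
open import Data.Nat using (ℕ; zero; suc; _+_; _*_; _≤_; _<_; z≤n; s≤s; s≤s⁻¹; >-nonZero; ≢-nonZero)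
open import Data.Nat.Properties
  using ( +-0-commutativeMonoid; +-suc; +-identityʳ; +-cancelˡ-≡; suc-injective; *-comm; *-zeroʳ; *-distribˡ-+
        ; *-cancelˡ-≡; *-cancelˡ-≤; *-mono-<; ≤-trans; ≤-antisym; <-trans; <⇒≱; m≤m+n; m≤n+m; m<m+n
        ; m≤n⇒m≤1+n; module ≤-Reasoning)
open import Data.Nat.Divisibility using (_∣_; divides; ∣-trans; ∣1⇒≡1; ∣m+n∣m⇒∣n; ∣m∣n⇒∣m+n; ∣m⇒∣m*n; m∣m*n; n∣m*n; ∣⇒≤; _∣0)
open import Data.Nat.Primality using (Prime)
open import Data.Nat.Coprimality using (Coprime; coprime-divisor)
import Data.Nat.Coprimality as Coprime
open import Data.Nat.Tactic.RingSolver using (solve; solve-∀)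
open import Data.Integer as ℤ using (ℤ; +_; -[1+_])
open import Data.Integer.Properties using (+-injective; pos-*)
import Data.Integer.Tactic.RingSolver as ℤ-Solver
open import Data.Fin using (Fin; zero; suc; _≟_)
open import Data.Fin.Properties using (any?)
open import Data.Fin.Permutation using (Permutation′)
import Data.Fin.Permutation as Perm
open import Data.List using (_∷_; [])
open import Data.Product using (Σ; ∃; ∃₂; _×_; _,_; proj₁; proj₂)
open import Data.Sum using (_⊎_; inj₁; inj₂)
open import Data.Empty using (⊥)
open import Function using (_∘_)
open import Algebra.Properties.CommutativeMonoid.Sum +-0-commutativeMonoid using (sum-syntax; ∑-comm; sum-cong-≗)
open import Relation.Binary.PropositionalEquality
open import Relation.Nullary using (¬_; yes; no; contradiction)

private
  variable
    N M c d l m n o : ℕ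
    f g : Fin N → Bool

-- Counting vertices

==-refl : (a : Fin N) → (a == a) ≡ true
==-refl a with a ≟ a
... | yes _   = refl
... | no a≢a = contradiction refl a≢a

==-suc : (a b : Fin N) → (suc a == suc b) ≡ (a == b)
==-suc a b with a ≟ b
... | yes _ = refl
... | no _  = refl

==-≢ : {a b : Fin N} → a ≢ b → (a == b) ≡ false
==-≢ {a = a} {b} a≢b with a ≟ b
... | yes a≡b = contradiction a≡b a≢b
... | no _    = refl

constant-on : (C : Fin N → Bool) (h : Fin N → ℕ) → (∀ z w → C z ≡ true → C w ≡ true → h z ≡ h w) →
              ∃ λ c → ∀ z → C z ≡ true → h z ≡ c
constant-on C h h-const with any? (λ z → C z Bool.≟ true)
... | yes (z₀ , z₀∈C) = h z₀ , λ z z∈C → h-const z z₀ z∈C z₀∈C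
... | no C-empty      = 0 , λ z z∈C → contradiction (z , z∈C) C-empty

count-cong : (∀ v → f v ≡ g v) → count f ≡ count g
count-cong {zero}  f≗g = refl
count-cong {suc N} f≗g = cong₂ _+_ (cong (λ b → if b then 1 else 0) (f≗g zero)) (count-cong (f≗g ∘ suc))

count-true : count {N} (λ _ → true) ≡ N
count-true {zero}  = refl
count-true {suc N} = cong suc (count-true {N})

count-false : count {N} (λ _ → false) ≡ 0
count-false {zero}  = refl
count-false {suc N} = count-false {N}

count-split : (f g : Fin N → Bool) →
              count f ≡ count (λ v → f v ∧ g v) + count (λ v → f v ∧ not (g v))
count-split {zero}  f g = refl
count-split {suc N} f g with f zero | g zero | count-split (f ∘ suc) (g ∘ suc)
... | false | _     | ih = ih
... | true  | true  | ih = cong suc ih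
... | true  | false | ih = trans (cong suc ih) (sym (+-suc _ _))

count-remove : (f : Fin N → Bool) (a : Fin N) → f a ≡ true →
               count f ≡ suc (count (λ v → f v ∧ not (v == a)))
count-remove {suc N} f zero    fa rewrite fa = cong suc (count-cong λ v → sym (∧-identityʳ (f (suc v))))
count-remove {suc N} f (suc a) fa with f zero | count-remove (f ∘ suc) a fa
... | true  | ih = cong suc (trans ih (cong suc (count-cong λ v → cong (λ b → f (suc v) ∧ not b) (sym (==-suc v a)))))
... | false | ih = trans ih (cong suc (count-cong λ v → cong (λ b → f (suc v) ∧ not b) (sym (==-suc v a))))

count≡0⇒false : count f ≡ 0 → ∀ v → f v ≡ false
count≡0⇒false {suc N} {f} count≡0 v with f zero in f₀
count≡0⇒false {suc N} {f} count≡0 zero    | false = f₀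
count≡0⇒false {suc N} {f} count≡0 (suc v) | false = count≡0⇒false {f = f ∘ suc} count≡0 v

count>0⇒∃ : 0 < count f → ∃ λ v → f v ≡ true
count>0⇒∃ {suc N} {f} count>0 with f zero in f₀
... | true  = zero , f₀
... | false with count>0⇒∃ {f = f ∘ suc} count>0
...   | v , fv = suc v , fv

count>1⇒∃₂ : 1 < count f → ∃₂ λ u v → u ≢ v × f u ≡ true × f v ≡ true
count>1⇒∃₂ {f = f} count>1 with count>0⇒∃ {f = f} (<-trans (s≤s z≤n) count>1)
... | u , fu with count>0⇒∃ {f = λ v → f v ∧ not (v == u)} (s≤s⁻¹ (subst (1 <_) (count-remove f u fu) count>1))
...   | v , fv∧v≢u = u , v , u≢v , fu , ∧-conicalˡ _ _ fv∧v≢u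
  where
  u≢v : u ≢ v
  u≢v refl with () ← trans (sym (∧-conicalʳ _ _ fv∧v≢u)) (cong not (==-refl u))

count-mono : (∀ v → f v ≡ true → g v ≡ true) → count f ≤ count g
count-mono {zero}          f⊆g = z≤n
count-mono {suc N} {f} {g} f⊆g with f zero in f₀ | g zero in g₀
... | true  | true  = s≤s (count-mono (f⊆g ∘ suc))
... | true  | false with () ← trans (sym (f⊆g zero f₀)) g₀
... | false | true  = m≤n⇒m≤1+n (count-mono (f⊆g ∘ suc))
... | false | false = count-mono (f⊆g ∘ suc)

count-∧-full : count (λ v → f v ∧ g v) ≡ count f → ∀ v → f v ≡ true → g v ≡ true
count-∧-full {f = f} {g} full v fv with g v | count≡0⇒false {f = λ u → f u ∧ not (g u)} f∖g-empty v
  where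
  f∖g-empty : count (λ u → f u ∧ not (g u)) ≡ 0
  f∖g-empty = +-cancelˡ-≡ (count (λ u → f u ∧ g u)) _ 0
    (trans (sym (count-split f g)) (trans (sym full) (sym (+-identityʳ _))))
... | true  | _ = refl
... | false | f∖g∌v with () ← trans (sym (cong (_∧ true) fv)) f∖g∌v

count≡∑ : (f : Fin N → Bool) → count f ≡ ∑[ v < N ] (if f v then 1 else 0)
count≡∑ {zero}  f = refl
count≡∑ {suc N} f = cong (λ t → (if f zero then 1 else 0) + t) (count≡∑ (f ∘ suc))

count-swap : (R : Fin N → Fin M → Bool) →
             ∑[ z < N ] count (R z) ≡ ∑[ v < M ] count (λ z → R z v)
count-swap {N} {M} R = begin
  ∑[ z < N ] count (R z)                               ≡⟨ sum-cong-≗ (λ z → count≡∑ (R z)) ⟩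
  ∑[ z < N ] ∑[ v < M ] (if R z v then 1 else 0)       ≡⟨ ∑-comm (λ z v → if R z v then 1 else 0) ⟩
  ∑[ v < M ] ∑[ z < N ] (if R z v then 1 else 0)       ≡⟨ sum-cong-≗ (λ v → count≡∑ (λ z → R z v)) ⟨
  ∑[ v < M ] count (λ z → R z v)                       ∎
  where open ≡-Reasoning

∑-count-∧ : (C : Fin N → Bool) (h : Fin N → Fin M → Bool) → (∀ z → C z ≡ true → count (h z) ≡ c) →
            ∑[ z < N ] count (λ v → C z ∧ h z v) ≡ count C * c
∑-count-∧ {zero}      C h h≡c = refl
∑-count-∧ {suc N} {M} C h h≡c with C zero in C₀
... | true  = cong₂ _+_ (h≡c zero C₀) (∑-count-∧ (C ∘ suc) (h ∘ suc) (h≡c ∘ suc))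
... | false = trans (cong (_+ ∑[ z < N ] count (λ v → C (suc z) ∧ h (suc z) v)) (count-false {M}))
                    (∑-count-∧ (C ∘ suc) (h ∘ suc) (h≡c ∘ suc))

double-counting : (C D : Fin N → Bool) (E : Fin N → Fin N → Bool) → (∀ u v → E u v ≡ E v u) →
                  (∀ z → C z ≡ true → count (λ v → D v ∧ E z v) ≡ c) →
                  (∀ v → D v ≡ true → count (λ z → C z ∧ E v z) ≡ d) →
                  count C * c ≡ count D * d
double-counting {N} C D E E-sym C→c D→d = begin
  count C * _                                      ≡⟨ ∑-count-∧ C (λ z v → D v ∧ E z v) C→c ⟨
  ∑[ z < N ] count (λ v → C z ∧ (D v ∧ E z v))     ≡⟨ count-swap (λ z v → C z ∧ (D v ∧ E z v)) ⟩
  ∑[ v < N ] count (λ z → C z ∧ (D v ∧ E z v))     ≡⟨ sum-cong-≗ (λ v → count-cong (λ z → reorder z v)) ⟩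
  ∑[ v < N ] count (λ z → D v ∧ (C z ∧ E v z))     ≡⟨ ∑-count-∧ D (λ v z → C z ∧ E v z) D→d ⟩
  count D * _                                      ∎
  where
  open ≡-Reasoning
  reorder : ∀ z v → C z ∧ (D v ∧ E z v) ≡ D v ∧ (C z ∧ E v z)
  reorder z v = trans (x∙yz≈y∙xz (C z) (D v) (E z v)) (cong (λ b → D v ∧ (C z ∧ b)) (E-sym z v))

-- Coprimality

Bézout⇒coprime : ∀ x y → m * x + 1 ≡ n * y → Coprime m n
Bézout⇒coprime {m} {n} x y eq {d} (d∣m , d∣n) =
  ∣1⇒≡1 (∣m+n∣m⇒∣n (subst (d ∣_) (sym eq) (∣m⇒∣m*n y d∣n)) (∣m⇒∣m*n x d∣m))

coprime-∣ʳ : Coprime m n → d ∣ n → Coprime m d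
coprime-∣ʳ m⊥n d∣n (e∣m , e∣d) = m⊥n (e∣m , ∣-trans e∣d d∣n)

coprime-*ʳ : Coprime m n → Coprime m o → Coprime m (n * o)
coprime-*ʳ m⊥n m⊥o (d∣m , d∣n*o) =
  m⊥o (d∣m , coprime-divisor (Coprime.sym (coprime-∣ʳ (Coprime.sym m⊥n) d∣m)) d∣n*o)

coprime-suc : ∀ n → Coprime n (suc n)
coprime-suc n = Bézout⇒coprime {n} {suc n} 1 1 (solve (n ∷ []))

2∣n*[1+n] : ∀ n → 2 ∣ n * suc n
2∣n*[1+n] zero    = 2 ∣0
2∣n*[1+n] (suc n) = subst (2 ∣_) next-product (∣m∣n⇒∣m+n (2∣n*[1+n] n) (m∣m*n (suc n)))
  where
  next-product : n * suc n + 2 * suc n ≡ suc n * suc (suc n)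
  next-product = solve (n ∷ [])

coprime-to-factors-of-suc : suc l ≡ n * suc n → Coprime l 2 × Coprime l n × Coprime l (suc n)
coprime-to-factors-of-suc {l} {n} eq =
  coprime-∣ʳ l⊥n*[1+n] (2∣n*[1+n] n) , coprime-∣ʳ l⊥n*[1+n] (m∣m*n (suc n)) , coprime-∣ʳ l⊥n*[1+n] (n∣m*n n)
  where
  l⊥n*[1+n] : Coprime l (n * suc n)
  l⊥n*[1+n] = subst (Coprime l) eq (coprime-suc l)

-- The neighbourhood of an edge

-- For a 3-isoregular edge xy of a strongly regular graph on N vertices: K₁ counts the neighbours
-- of x other than y that are not adjacent to y, and K₀ the vertices adjacent to neither x nor y;
-- α, β, γ are the valencies of {x, y, z} for z a common neighbour of x and y, in the first class
-- and in the second class; p and q count the neighbours of a common neighbour in these classes.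
record IsoregularEdgeCounts (N k l m : ℕ) : Set where
  field
    K₁ K₀ α β γ p q : ℕ
    degree-split : k ≡ l + suc K₁
    order-split  : N ≡ k + (suc K₁ + K₀)
    common-split : l ≡ α + suc p
    p+q≡K₁       : p + q ≡ K₁
    K₁β≡lp       : K₁ * β ≡ l * p
    K₀γ≡lq       : K₀ * γ ≡ l * q
    μ-bound      : β ≡ l → α ≡ 0 → 2 ≤ l → suc K₁ ≤ m

adj⇒≢ : (G : Graph N) {u v : Fin N} → adj G u v ≡ true → u ≢ v
adj⇒≢ G {u} u~v refl with () ← trans (sym u~v) (adj-irr G u)

module EdgeNeighbourhood {N : ℕ} (Γ : Graph N) {k l m : ℕ} (srg : IsSRG Γ k l m)
                         {x y : Fin N} (x~y : adj Γ x y ≡ true) where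

  infix 7 _~_
  _~_ : Fin N → Fin N → Bool
  _~_ = adj Γ

  ~-sym : ∀ {u v} → u ~ v ≡ true → v ~ u ≡ true
  ~-sym {u} {v} u~v = trans (adj-sym Γ v u) u~v

  degree≡k : ∀ u → count (u ~_) ≡ k
  degree≡k = proj₁ srg

  commonNbrs-adjacent : ∀ {u v} → u ~ v ≡ true → commonNbrs Γ u v ≡ l
  commonNbrs-adjacent u~v = proj₁ (proj₂ srg) _ _ (adj⇒≢ Γ u~v) u~v

  commonNbrs-nonadjacent : ∀ {u v} → u ≢ v → u ~ v ≡ false → commonNbrs Γ u v ≡ m
  commonNbrs-nonadjacent = proj₂ (proj₂ srg) _ _

  common onlyX neither : Fin N → Bool
  common  v = x ~ v ∧ y ~ v
  onlyX   v = (x ~ v ∧ not (y ~ v)) ∧ not (v == y)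
  neither v = not (x ~ v) ∧ not (y ~ v)

  K₁ K₀ : ℕ
  K₁ = count onlyX
  K₀ = count neither

  valency : Fin N → ℕ
  valency = valency3 Γ x y

  valency≡count-common : ∀ z → valency z ≡ count (λ v → common v ∧ z ~ v)
  valency≡count-common z = count-cong λ v → sym (∧-assoc (x ~ v) (y ~ v) (z ~ v))

  count-x∖y : count (λ v → x ~ v ∧ not (y ~ v)) ≡ suc K₁
  count-x∖y = count-remove _ y y∈x∖y
    where
    y∈x∖y : x ~ y ∧ not (y ~ y) ≡ true
    y∈x∖y rewrite x~y | adj-irr Γ y = refl

  x∖y⇒onlyX : ∀ {v} → v ≢ y → x ~ v ∧ not (y ~ v) ≡ true → onlyX v ≡ true
  x∖y⇒onlyX {v} v≢y v∈ rewrite ==-≢ v≢y | ∧-identityʳ (x ~ v ∧ not (y ~ v)) = v∈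

  degree-split : k ≡ l + suc K₁
  degree-split = begin
    k                                                  ≡⟨ degree≡k x ⟨
    count (x ~_)                                       ≡⟨ count-split (x ~_) (y ~_) ⟩
    count common + count (λ v → x ~ v ∧ not (y ~ v))   ≡⟨ cong₂ _+_ (commonNbrs-adjacent x~y) count-x∖y ⟩
    l + suc K₁                                         ∎
    where open ≡-Reasoning

  count-y∖x : count (λ v → not (x ~ v) ∧ y ~ v) ≡ suc K₁
  count-y∖x = +-cancelˡ-≡ l _ _ (begin
    l + count (λ v → not (x ~ v) ∧ y ~ v)
      ≡⟨ cong₂ _+_ (commonNbrs-adjacent (~-sym x~y)) (count-cong λ v → ∧-comm (y ~ v) (not (x ~ v))) ⟨
    count (λ v → y ~ v ∧ x ~ v) + count (λ v → y ~ v ∧ not (x ~ v))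
      ≡⟨ count-split (y ~_) (x ~_) ⟨
    count (y ~_)
      ≡⟨ degree≡k y ⟩
    k
      ≡⟨ degree-split ⟩
    l + suc K₁ ∎)
    where open ≡-Reasoning

  order-split : N ≡ k + (suc K₁ + K₀)
  order-split = begin
    N                                               ≡⟨ count-true {N} ⟨
    count {N} (λ _ → true)                          ≡⟨ count-split (λ _ → true) (x ~_) ⟩
    count (x ~_) + count (λ v → not (x ~ v))        ≡⟨ cong₂ _+_ (degree≡k x) (count-split (λ v → not (x ~ v)) (y ~_)) ⟩
    k + (count (λ v → not (x ~ v) ∧ y ~ v) + K₀)    ≡⟨ cong (λ c → k + (c + K₀)) count-y∖x ⟩
    k + (suc K₁ + K₀)                               ∎
    where open ≡-Reasoning

  p q : Fin N → ℕ
  p w = count (λ v → onlyX v ∧ w ~ v)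
  q w = count (λ v → neither v ∧ w ~ v)

  module _ {w : Fin N} (w∈common : common w ≡ true) where

    private
      x~w : x ~ w ≡ true
      x~w = ∧-conicalˡ _ _ w∈common
      y~w : y ~ w ≡ true
      y~w = ∧-conicalʳ _ _ w∈common
      r : ℕ
      r = count (λ v → (w ~ v ∧ y ~ v) ∧ not (x ~ v))

    common-split : l ≡ valency w + suc (p w)
    common-split = begin
      l                                                        ≡⟨ commonNbrs-adjacent x~w ⟨
      count (λ v → x ~ v ∧ w ~ v)                              ≡⟨ count-split _ (y ~_) ⟩
      count (λ v → (x ~ v ∧ w ~ v) ∧ y ~ v)
        + count (λ v → (x ~ v ∧ w ~ v) ∧ not (y ~ v))          ≡⟨ cong₂ _+_ (count-cong λ v → xy∙z≈x∙zy (x ~ v) (w ~ v) (y ~ v))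
                                                                            (count-remove _ y y∈x∖y) ⟩
      valency w + suc (count (λ v → ((x ~ v ∧ w ~ v) ∧ not (y ~ v)) ∧ not (v == y)))
                                                               ≡⟨ cong (λ c → valency w + suc c) (count-cong reorder) ⟩
      valency w + suc (p w)                                    ∎
      where
      open ≡-Reasoning
      y∈x∖y : (x ~ y ∧ w ~ y) ∧ not (y ~ y) ≡ true
      y∈x∖y rewrite x~y | ~-sym y~w | adj-irr Γ y = refl
      reorder : ∀ v → ((x ~ v ∧ w ~ v) ∧ not (y ~ v)) ∧ not (v == y) ≡ onlyX v ∧ w ~ v
      reorder v = trans (cong (_∧ not (v == y)) (xy∙z≈xz∙y (x ~ v) (w ~ v) (not (y ~ v))))
                        (xy∙z≈xz∙y (x ~ v ∧ not (y ~ v)) (w ~ v) (not (v == y)))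

    private
      y-split : l ≡ valency w + r
      y-split = begin
        l                                              ≡⟨ commonNbrs-adjacent (~-sym y~w) ⟨
        count (λ v → w ~ v ∧ y ~ v)                    ≡⟨ count-split _ (x ~_) ⟩
        count (λ v → (w ~ v ∧ y ~ v) ∧ x ~ v) + r      ≡⟨ cong (_+ r) (count-cong λ v → xy∙z≈z∙yx (w ~ v) (y ~ v) (x ~ v)) ⟩
        valency w + r                                  ∎
        where open ≡-Reasoning

      w-split : k ≡ l + (r + q w)
      w-split = begin
        k                                                            ≡⟨ degree≡k w ⟨
        count (w ~_)                                                 ≡⟨ count-split (w ~_) (x ~_) ⟩
        count (λ v → w ~ v ∧ x ~ v) + count (λ v → w ~ v ∧ not (x ~ v))
                                                                     ≡⟨ cong₂ _+_ (commonNbrs-adjacent (~-sym x~w)) (count-split _ (y ~_)) ⟩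
        l + (count (λ v → (w ~ v ∧ not (x ~ v)) ∧ y ~ v)
             + count (λ v → (w ~ v ∧ not (x ~ v)) ∧ not (y ~ v)))    ≡⟨ cong (λ t → l + t) (cong₂ _+_
                                                                          (count-cong λ v → xy∙z≈xz∙y (w ~ v) (not (x ~ v)) (y ~ v))
                                                                          (count-cong λ v → xy∙z≈yz∙x (w ~ v) (not (x ~ v)) (not (y ~ v)))) ⟩
        l + (r + q w)                                                ∎
        where open ≡-Reasoning

    degree-split-at : k ≡ l + (suc (p w) + q w)
    degree-split-at = trans w-split (cong (λ c → l + (c + q w)) r≡1+p)
      where
      r≡1+p : r ≡ suc (p w)
      r≡1+p = +-cancelˡ-≡ (valency w) _ _ (trans (sym y-split) common-split)

  -- Two common neighbours of x and y are then non-adjacent, and both are adjacent to every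
  -- neighbour of x outside the neighbourhood of y.
  μ-bound : (∀ z → onlyX z ≡ true → valency z ≡ l) → (∀ w → common w ≡ true → valency w ≡ 0) →
            2 ≤ l → suc K₁ ≤ m
  μ-bound onlyX-joined common-independent 2≤l
    with count>1⇒∃₂ {f = common} (subst (1 <_) (sym (commonNbrs-adjacent x~y)) 2≤l)
  ... | w , w′ , w≢w′ , w∈ , w′∈ = begin
    suc K₁                                ≡⟨ count-x∖y ⟨
    count (λ v → x ~ v ∧ not (y ~ v))     ≤⟨ count-mono x∖y⊆common-w-w′ ⟩
    commonNbrs Γ w w′                     ≡⟨ commonNbrs-nonadjacent w≢w′ w≁w′ ⟩
    m                                     ∎
    where
    open ≤-Reasoning
    w≁w′ : w ~ w′ ≡ false
    w≁w′ = trans (sym (cong₂ (λ a b → a ∧ (b ∧ w ~ w′)) (∧-conicalˡ (x ~ w′) (y ~ w′) w′∈) (∧-conicalʳ (x ~ w′) (y ~ w′) w′∈)))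
                 (count≡0⇒false (common-independent w w∈) w′)
    joined : ∀ {z u} → onlyX z ≡ true → common u ≡ true → u ~ z ≡ true
    joined {z} {u} z∈ u∈ = ~-sym (count-∧-full all-common u u∈)
      where
      all-common : count (λ v → common v ∧ z ~ v) ≡ count common
      all-common = trans (sym (valency≡count-common z)) (trans (onlyX-joined z z∈) (sym (commonNbrs-adjacent x~y)))
    x∖y⊆common-w-w′ : ∀ v → x ~ v ∧ not (y ~ v) ≡ true → w ~ v ∧ w′ ~ v ≡ true
    x∖y⊆common-w-w′ v v∈ with v ≟ y
    ... | yes refl rewrite ~-sym (∧-conicalʳ _ _ w∈) | ~-sym (∧-conicalʳ _ _ w′∈) = refl
    ... | no v≢y rewrite joined (x∖y⇒onlyX v≢y v∈) w∈ | joined (x∖y⇒onlyX v≢y v∈) w′∈ = refl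

  Isoregular : Set
  Isoregular = ∀ z w → z ≢ x → z ≢ y → w ≢ x → w ≢ y → InducedIso Γ x y z w → valency z ≡ valency w

  OfType : Bool → Bool → Fin N → Set
  OfType a b z = z ≢ x × z ≢ y × x ~ z ≡ a × y ~ z ≡ b

  common⇒type : ∀ {z} → common z ≡ true → OfType true true z
  common⇒type {z} z∈ = ≢-sym (adj⇒≢ Γ x~z) , ≢-sym (adj⇒≢ Γ y~z) , x~z , y~z
    where
    x~z : x ~ z ≡ true
    x~z = ∧-conicalˡ _ _ z∈
    y~z : y ~ z ≡ true
    y~z = ∧-conicalʳ _ _ z∈

  onlyX⇒type : ∀ {z} → onlyX z ≡ true → OfType true false z
  onlyX⇒type {z} z∈ = ≢-sym (adj⇒≢ Γ x~z) , z≢y , x~z , not-injective (∧-conicalʳ _ _ z∈x∖y)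
    where
    z∈x∖y : x ~ z ∧ not (y ~ z) ≡ true
    z∈x∖y = ∧-conicalˡ _ _ z∈
    x~z : x ~ z ≡ true
    x~z = ∧-conicalˡ _ _ z∈x∖y
    z≢y : z ≢ y
    z≢y refl with () ← trans (sym (∧-conicalʳ _ _ z∈)) (cong not (==-refl y))

  neither⇒type : ∀ {z} → neither z ≡ true → OfType false false z
  neither⇒type {z} z∈ = z≢x , z≢y , x≁z , y≁z
    where
    x≁z : x ~ z ≡ false
    x≁z = not-injective (∧-conicalˡ _ _ z∈)
    y≁z : y ~ z ≡ false
    y≁z = not-injective (∧-conicalʳ _ _ z∈)
    z≢x : z ≢ x
    z≢x refl with () ← trans (sym (~-sym x~y)) y≁z
    z≢y : z ≢ y
    z≢y refl with () ← trans (sym x~y) x≁z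

  module _ (iso : Isoregular) where

    valency-cong : ∀ {a b z w} → OfType a b z → OfType a b w → valency z ≡ valency w
    valency-cong {z = z} {w} (z≢x , z≢y , x~z , y~z) (w≢x , w≢y , x~w , y~w) =
      iso z w z≢x z≢y w≢x w≢y (Perm.id , same-triangle)
      where
      same-triangle : ∀ i j → adj Γ (triple x y z i) (triple x y z j) ≡ adj Γ (triple x y w i) (triple x y w j)
      same-triangle zero             zero             = refl
      same-triangle zero             (suc zero)       = refl
      same-triangle zero             (suc (suc zero)) = trans x~z (sym x~w)
      same-triangle (suc zero)       zero             = refl
      same-triangle (suc zero)       (suc zero)       = refl
      same-triangle (suc zero)       (suc (suc zero)) = trans y~z (sym y~w)
      same-triangle (suc (suc zero)) zero             = trans (adj-sym Γ z x) (trans x~z (trans (sym x~w) (adj-sym Γ x w)))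
      same-triangle (suc (suc zero)) (suc zero)       = trans (adj-sym Γ z y) (trans y~z (trans (sym y~w) (adj-sym Γ y w)))
      same-triangle (suc (suc zero)) (suc (suc zero)) = trans (adj-irr Γ z) (sym (adj-irr Γ w))

    valency-constant-on : ∀ {a b} (C : Fin N → Bool) → (∀ {z} → C z ≡ true → OfType a b z) →
                          ∃ λ c → ∀ z → C z ≡ true → valency z ≡ c
    valency-constant-on C type = constant-on C valency λ z w z∈C w∈C → valency-cong (type z∈C) (type w∈C)

    isoregular-edge-counts : 0 < l → IsoregularEdgeCounts N k l m
    isoregular-edge-counts 0<l
      with valency-constant-on common common⇒type | valency-constant-on onlyX onlyX⇒type
         | valency-constant-on neither neither⇒type
         | count>0⇒∃ {f = common} (subst (0 <_) (sym (commonNbrs-adjacent x~y)) 0<l)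
    ... | α , valency≡α | β , valency≡β | γ , valency≡γ | w₀ , w₀∈ = record
      { K₁ = K₁ ; K₀ = K₀ ; α = α ; β = β ; γ = γ ; p = p w₀ ; q = q w₀
      ; degree-split = degree-split
      ; order-split  = order-split
      ; common-split = l≡α+1+p w₀∈
      ; p+q≡K₁       = suc-injective (+-cancelˡ-≡ l _ _ (trans (sym (degree-split-at w₀∈)) degree-split))
      ; K₁β≡lp       = by-double-counting onlyX (λ z z∈ → trans (sym (valency≡count-common z)) (valency≡β z z∈)) p-const
      ; K₀γ≡lq       = by-double-counting neither (λ z z∈ → trans (sym (valency≡count-common z)) (valency≡γ z z∈)) q-const
      ; μ-bound      = λ β≡l α≡0 → μ-bound (λ z z∈ → trans (valency≡β z z∈) β≡l) (λ w w∈ → trans (valency≡α w w∈) α≡0)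
      }
      where
      l≡α+1+p : ∀ {w} → common w ≡ true → l ≡ α + suc (p w)
      l≡α+1+p {w} w∈ = trans (common-split w∈) (cong (_+ suc (p w)) (valency≡α w w∈))

      p-const : ∀ w → common w ≡ true → p w ≡ p w₀
      p-const w w∈ = suc-injective (+-cancelˡ-≡ α _ _ (trans (sym (l≡α+1+p w∈)) (l≡α+1+p w₀∈)))

      q-const : ∀ w → common w ≡ true → q w ≡ q w₀
      q-const w w∈ = +-cancelˡ-≡ (suc (p w₀)) _ _ (+-cancelˡ-≡ l _ _ (begin
        l + (suc (p w₀) + q w)    ≡⟨ cong (λ c → l + (suc c + q w)) (p-const w w∈) ⟨
        l + (suc (p w) + q w)     ≡⟨ degree-split-at w∈ ⟨
        k                         ≡⟨ degree-split-at w₀∈ ⟩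
        l + (suc (p w₀) + q w₀)   ∎))
        where open ≡-Reasoning

      by-double-counting : ∀ {c d} (C : Fin N → Bool) →
                           (∀ z → C z ≡ true → count (λ v → common v ∧ z ~ v) ≡ c) →
                           (∀ w → common w ≡ true → count (λ z → C z ∧ w ~ z) ≡ d) →
                           count C * c ≡ l * d
      by-double-counting {d = d} C C→c common→d =
        trans (double-counting C common _~_ (adj-sym Γ) C→c common→d) (cong (_* d) (commonNbrs-adjacent x~y))

-- The arithmetic of the counts

-- As p + q = K₁, l K₁ = K₁ β + K₀ γ, and K₀ : K₁ = f : a turns this into a l = a β + f γ.
-- So β ≤ l, while l ∣ β since l is prime to K₁; and β = 0 would give f ∣ a, against a < f.
β≡l : ∀ {l K₁ K₀ p q β γ} a f → 0 < a → a < f → 0 < K₁ → Coprime l K₁ → Coprime l f →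
      a * K₀ ≡ f * K₁ → p + q ≡ K₁ → K₁ * β ≡ l * p → K₀ * γ ≡ l * q → β ≡ l
β≡l {l} {K₁} {K₀} {p} {q} {β} {γ} a f 0<a a<f 0<K₁ l⊥K₁ l⊥f aK₀≡fK₁ p+q≡K₁ K₁β≡lp K₀γ≡lq =
  ≤-antisym β≤l (∣⇒≤ {{≢-nonZero β≢0}} l∣β)
  where
  open ≡-Reasoning
  al≡aβ+fγ : a * l ≡ a * β + f * γ
  al≡aβ+fγ = *-cancelˡ-≡ _ _ K₁ {{>-nonZero 0<K₁}} (begin
    K₁ * (a * l)                  ≡⟨ solve (K₁ ∷ a ∷ l ∷ []) ⟩
    a * (l * K₁)                  ≡⟨ cong (λ K → a * (l * K)) p+q≡K₁ ⟨
    a * (l * (p + q))             ≡⟨ cong (a *_) (*-distribˡ-+ l p q) ⟩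
    a * (l * p + l * q)           ≡⟨ cong₂ (λ u v → a * (u + v)) K₁β≡lp K₀γ≡lq ⟨
    a * (K₁ * β + K₀ * γ)         ≡⟨ solve (a ∷ K₁ ∷ β ∷ K₀ ∷ γ ∷ []) ⟩
    K₁ * (a * β) + (a * K₀) * γ   ≡⟨ cong (λ c → K₁ * (a * β) + c * γ) aK₀≡fK₁ ⟩
    K₁ * (a * β) + (f * K₁) * γ   ≡⟨ solve (K₁ ∷ a ∷ β ∷ f ∷ γ ∷ []) ⟩
    K₁ * (a * β + f * γ)          ∎)

  β≤l : β ≤ l
  β≤l = *-cancelˡ-≤ a {{>-nonZero 0<a}} (subst (a * β ≤_) (sym al≡aβ+fγ) (m≤m+n (a * β) (f * γ)))

  l∣β : l ∣ β
  l∣β = coprime-divisor l⊥K₁ (divides p (trans K₁β≡lp (*-comm l p)))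

  β≢0 : β ≢ 0
  β≢0 β≡0 = <⇒≱ a<f (∣⇒≤ {{>-nonZero 0<a}} f∣a)
    where
    la≡γf : l * a ≡ γ * f
    la≡γf = begin
      l * a               ≡⟨ *-comm l a ⟩
      a * l               ≡⟨ al≡aβ+fγ ⟩
      a * β + f * γ       ≡⟨ cong (λ b → a * b + f * γ) β≡0 ⟩
      a * 0 + f * γ       ≡⟨ cong (_+ f * γ) (*-zeroʳ a) ⟩
      f * γ               ≡⟨ *-comm f γ ⟩
      γ * f               ∎
    f∣a : f ∣ a
    f∣a = coprime-divisor (Coprime.sym l⊥f) (divides γ la≡γf)

module _ {N k l m : ℕ} (r : IsoregularEdgeCounts N k l m) where
  open IsoregularEdgeCounts r

  β≡l⇒l≡α+1+K₁ : β ≡ l → l ≡ α + suc K₁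
  β≡l⇒l≡α+1+K₁ β≡l = trans common-split (cong (λ c → α + suc c) p≡K₁)
    where
    0<l : 0 < l
    0<l = subst (0 <_) (sym common-split) (≤-trans (s≤s z≤n) (m≤n+m (suc p) α))
    p≡K₁ : p ≡ K₁
    p≡K₁ = *-cancelˡ-≡ p K₁ l {{>-nonZero 0<l}} (trans (sym K₁β≡lp) (trans (cong (K₁ *_) β≡l) (*-comm K₁ l)))

  strict-or-μ-bound : β ≡ l → 0 < K₁ → suc K₁ < l ⊎ suc K₁ ≤ m
  strict-or-μ-bound β≡l 0<K₁ with α in α≡ | β≡l⇒l≡α+1+K₁ β≡l
  ... | zero   | l≡1+K₁   = inj₂ (μ-bound β≡l α≡ (subst (2 ≤_) (sym l≡1+K₁) (s≤s 0<K₁)))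
  ... | suc α′ | l≡α+1+K₁ = inj₁ (subst (suc K₁ <_) (sym l≡α+1+K₁) (s≤s (m≤n+m (suc K₁) α′)))

  counts-impossible : ∀ a e → 0 < a → 0 < e → K₁ ≡ 2 * a * e → K₀ ≡ 2 * (a + e) * e →
                      Coprime l 2 → Coprime l a → Coprime l e → Coprime l (a + e) →
                      l ≤ suc K₁ → m < suc K₁ → ⊥
  counts-impossible a e 0<a 0<e K₁≡2ae K₀≡2[a+e]e l⊥2 l⊥a l⊥e l⊥a+e l≤1+K₁ m<1+K₁
    with strict-or-μ-bound (β≡l a (a + e) 0<a (m<m+n a 0<e) 0<K₁ l⊥K₁ l⊥a+e aK₀≡[a+e]K₁ p+q≡K₁ K₁β≡lp K₀γ≡lq) 0<K₁
    where
    0<K₁ : 0 < K₁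
    0<K₁ = subst (0 <_) (sym K₁≡2ae) (*-mono-< {0} {2 * a} (*-mono-< {0} {2} (s≤s z≤n) 0<a) 0<e)
    l⊥K₁ : Coprime l K₁
    l⊥K₁ = subst (Coprime l) (sym K₁≡2ae) (coprime-*ʳ (coprime-*ʳ l⊥2 l⊥a) l⊥e)
    aK₀≡[a+e]K₁ : a * K₀ ≡ (a + e) * K₁
    aK₀≡[a+e]K₁ rewrite K₀≡2[a+e]e | K₁≡2ae = solve (a ∷ e ∷ [])
  ... | inj₁ 1+K₁<l = <⇒≱ 1+K₁<l l≤1+K₁
  ... | inj₂ 1+K₁≤m = <⇒≱ m<1+K₁ 1+K₁≤m

-- The family of parameters

InFamily : ℤ → ℕ → ℕ → ℕ → ℕ → Set
InFamily s n k l m =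
  (+ n ≡ + 3 ℤ.* s ℤ.* s ℤ.- + 3 ℤ.* s ℤ.+ + 1) ×
  (+ k ≡ s ℤ.* (+ 3 ℤ.* s ℤ.- + 1)) ×
  (+ l ≡ s ℤ.* s ℤ.+ s ℤ.- + 1) ×
  (+ m ≡ s ℤ.* s)

module ParameterFormulas {n k l m : ℕ} (r : IsoregularEdgeCounts (3 * n) k l m) (s : ℤ)
                         (hn : + n ≡ + 3 ℤ.* s ℤ.* s ℤ.- + 3 ℤ.* s ℤ.+ + 1)
                         (hk : + k ≡ s ℤ.* (+ 3 ℤ.* s ℤ.- + 1))
                         (hl : + l ≡ s ℤ.* s ℤ.+ s ℤ.- + 1) where

  open IsoregularEdgeCounts r
  open ≡-Reasoning

  K₁-formula : + K₁ ≡ + 2 ℤ.* s ℤ.* (s ℤ.- + 1)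
  K₁-formula = begin
    + K₁                                                           ≡⟨ isolate (+ K₁) (+ l) ⟩
    (+ l ℤ.+ (+ 1 ℤ.+ + K₁)) ℤ.- + l ℤ.- + 1                        ≡⟨ cong (λ i → i ℤ.- + l ℤ.- + 1) (cong +_ degree-split) ⟨
    + k ℤ.- + l ℤ.- + 1                                             ≡⟨ cong₂ (λ i j → i ℤ.- j ℤ.- + 1) hk hl ⟩
    s ℤ.* (+ 3 ℤ.* s ℤ.- + 1) ℤ.- (s ℤ.* s ℤ.+ s ℤ.- + 1) ℤ.- + 1   ≡⟨ simplify s ⟩
    + 2 ℤ.* s ℤ.* (s ℤ.- + 1)                                       ∎
    where
    isolate : ∀ i j → i ≡ (j ℤ.+ (+ 1 ℤ.+ i)) ℤ.- j ℤ.- + 1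
    isolate = ℤ-Solver.solve-∀
    simplify : ∀ s → s ℤ.* (+ 3 ℤ.* s ℤ.- + 1) ℤ.- (s ℤ.* s ℤ.+ s ℤ.- + 1) ℤ.- + 1 ≡ + 2 ℤ.* s ℤ.* (s ℤ.- + 1)
    simplify = ℤ-Solver.solve-∀

  K₀-formula : + K₀ ≡ + 2 ℤ.* (+ 2 ℤ.* s ℤ.- + 1) ℤ.* (s ℤ.- + 1)
  K₀-formula = begin
    + K₀
      ≡⟨ isolate (+ K₀) (+ k) (+ K₁) ⟩
    (+ k ℤ.+ ((+ 1 ℤ.+ + K₁) ℤ.+ + K₀)) ℤ.- + k ℤ.- + 1 ℤ.- + K₁
      ≡⟨ cong (λ i → i ℤ.- + k ℤ.- + 1 ℤ.- + K₁) (trans (sym (pos-* 3 n)) (cong +_ order-split)) ⟨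
    + 3 ℤ.* + n ℤ.- + k ℤ.- + 1 ℤ.- + K₁
      ≡⟨ cong₂ (λ i j → + 3 ℤ.* i ℤ.- j ℤ.- + 1 ℤ.- + K₁) hn hk ⟩
    + 3 ℤ.* (+ 3 ℤ.* s ℤ.* s ℤ.- + 3 ℤ.* s ℤ.+ + 1) ℤ.- s ℤ.* (+ 3 ℤ.* s ℤ.- + 1) ℤ.- + 1 ℤ.- + K₁
      ≡⟨ cong (λ i → + 3 ℤ.* (+ 3 ℤ.* s ℤ.* s ℤ.- + 3 ℤ.* s ℤ.+ + 1) ℤ.- s ℤ.* (+ 3 ℤ.* s ℤ.- + 1) ℤ.- + 1 ℤ.- i) K₁-formula ⟩
    + 3 ℤ.* (+ 3 ℤ.* s ℤ.* s ℤ.- + 3 ℤ.* s ℤ.+ + 1) ℤ.- s ℤ.* (+ 3 ℤ.* s ℤ.- + 1) ℤ.- + 1 ℤ.- + 2 ℤ.* s ℤ.* (s ℤ.- + 1)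
      ≡⟨ simplify s ⟩
    + 2 ℤ.* (+ 2 ℤ.* s ℤ.- + 1) ℤ.* (s ℤ.- + 1) ∎
    where
    isolate : ∀ i j h → i ≡ (j ℤ.+ ((+ 1 ℤ.+ h) ℤ.+ i)) ℤ.- j ℤ.- + 1 ℤ.- h
    isolate = ℤ-Solver.solve-∀
    simplify : ∀ s → + 3 ℤ.* (+ 3 ℤ.* s ℤ.* s ℤ.- + 3 ℤ.* s ℤ.+ + 1) ℤ.- s ℤ.* (+ 3 ℤ.* s ℤ.- + 1) ℤ.- + 1
                       ℤ.- + 2 ℤ.* s ℤ.* (s ℤ.- + 1)
                     ≡ + 2 ℤ.* (+ 2 ℤ.* s ℤ.- + 1) ℤ.* (s ℤ.- + 1)
    simplify = ℤ-Solver.solve-∀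

-- Integer arithmetic on terms + (c + u) with c ≥ 1 computes to + of the corresponding natural
-- number, so each closed form below transfers to ℕ by +-injective once the integer side is
-- rewritten (by the ring solver, at v = + u) into sums and products of such terms.
excluded-s≥2 : ∀ u {n k l m} → InFamily (+ (2 + u)) n k l m → (0 < l → IsoregularEdgeCounts (3 * n) k l m) → ⊥
excluded-s≥2 u {l = l} {m} (hn , hk , hl , hm) counts =
  counts-impossible r a e (s≤s z≤n) (s≤s z≤n) K₁≡2ae K₀≡2[a+e]e l⊥2 l⊥a l⊥e l⊥a+e l≤1+K₁ m<1+K₁
  where
  a e L : ℕ
  a = 2 + u
  e = 1 + u
  L = (1 + u) * (4 + u) + 1

  l≡L : l ≡ L
  l≡L = +-injective (trans hl (closed-form (+ u)))
    where
    closed-form : ∀ v → (+ 2 ℤ.+ v) ℤ.* (+ 2 ℤ.+ v) ℤ.+ (+ 2 ℤ.+ v) ℤ.- + 1 ≡ (+ 1 ℤ.+ v) ℤ.* (+ 4 ℤ.+ v) ℤ.+ + 1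
    closed-form = ℤ-Solver.solve-∀

  r : IsoregularEdgeCounts _ _ l m
  r = counts (subst (0 <_) (sym l≡L) (s≤s z≤n))
  open IsoregularEdgeCounts r
  open ParameterFormulas r (+ (2 + u)) hn hk hl

  K₁≡2ae : K₁ ≡ 2 * a * e
  K₁≡2ae = +-injective K₁-formula

  K₀≡2[a+e]e : K₀ ≡ 2 * (a + e) * e
  K₀≡2[a+e]e = +-injective (trans K₀-formula (closed-form (+ u)))
    where
    closed-form : ∀ v → + 2 ℤ.* (+ 2 ℤ.* (+ 2 ℤ.+ v) ℤ.- + 1) ℤ.* ((+ 2 ℤ.+ v) ℤ.- + 1)
                        ≡ + 2 ℤ.* ((+ 2 ℤ.+ v) ℤ.+ (+ 1 ℤ.+ v)) ℤ.* (+ 1 ℤ.+ v)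
    closed-form = ℤ-Solver.solve-∀

  1+L≡a[1+a] : suc L ≡ a * suc a
  1+L≡a[1+a] = identity u
    where
    identity : ∀ (u : ℕ) → 1 + ((1 + u) * (4 + u) + 1) ≡ (2 + u) * (3 + u)
    identity = solve-∀

  l⊥2 : Coprime l 2
  l⊥2 = subst (λ i → Coprime i 2) (sym l≡L) (proj₁ (coprime-to-factors-of-suc {n = a} 1+L≡a[1+a]))
  l⊥a : Coprime l a
  l⊥a = subst (λ i → Coprime i a) (sym l≡L) (proj₁ (proj₂ (coprime-to-factors-of-suc {n = a} 1+L≡a[1+a])))
  l⊥e : Coprime l e
  l⊥e = subst (λ i → Coprime i e) (sym l≡L) (Coprime.sym (Bézout⇒coprime (4 + u) 1 (bezout u)))
    where
    bezout : ∀ (u : ℕ) → (1 + u) * (4 + u) + 1 ≡ ((1 + u) * (4 + u) + 1) * 1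
    bezout = solve-∀
  l⊥a+e : Coprime l (a + e)
  l⊥a+e = subst (λ i → Coprime i (a + e)) (sym l≡L) (Bézout⇒coprime 4 (7 + 2 * u) (bezout u))
    where
    bezout : ∀ (u : ℕ) → ((1 + u) * (4 + u) + 1) * 4 + 1 ≡ ((2 + u) + (1 + u)) * (7 + 2 * u)
    bezout = solve-∀

  l≤1+K₁ : l ≤ suc K₁
  l≤1+K₁ = subst₂ _≤_ (sym l≡L) (trans (gap u) (cong suc (sym K₁≡2ae))) (m≤m+n L (u * (1 + u)))
    where
    gap : ∀ (u : ℕ) → (1 + u) * (4 + u) + 1 + u * (1 + u) ≡ 1 + 2 * (2 + u) * (1 + u)
    gap = solve-∀

  m<1+K₁ : m < suc K₁
  m<1+K₁ = subst₂ _<_ (sym (+-injective hm)) (trans (gap u) (cong suc (sym K₁≡2ae))) (s≤s (m≤m+n (a * a) (u * (2 + u))))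
    where
    gap : ∀ (u : ℕ) → 1 + ((2 + u) * (2 + u) + u * (2 + u)) ≡ 1 + 2 * (2 + u) * (1 + u)
    gap = solve-∀

excluded-s≤-2 : ∀ u {n k l m} → InFamily -[1+ suc u ] n k l m → (0 < l → IsoregularEdgeCounts (3 * n) k l m) → ⊥
excluded-s≤-2 u {l = l} {m} (hn , hk , hl , hm) counts =
  counts-impossible r a e (s≤s z≤n) (s≤s z≤n) K₁≡2ae K₀≡2[a+e]e l⊥2 l⊥a l⊥e l⊥a+e l≤1+K₁ m<1+K₁
  where
  a e L : ℕ
  a = 2 + u
  e = 3 + u
  L = (1 + u) * (1 + u) + u

  l≡L : l ≡ L
  l≡L = +-injective (trans hl (closed-form (+ u)))
    where
    closed-form : ∀ v → ℤ.- (+ 2 ℤ.+ v) ℤ.* ℤ.- (+ 2 ℤ.+ v) ℤ.+ ℤ.- (+ 2 ℤ.+ v) ℤ.- + 1 ≡ (+ 1 ℤ.+ v) ℤ.* (+ 1 ℤ.+ v) ℤ.+ v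
    closed-form = ℤ-Solver.solve-∀

  r : IsoregularEdgeCounts _ _ l m
  r = counts (subst (0 <_) (sym l≡L) (s≤s z≤n))
  open IsoregularEdgeCounts r
  open ParameterFormulas r -[1+ suc u ] hn hk hl

  K₁≡2ae : K₁ ≡ 2 * a * e
  K₁≡2ae = +-injective (trans K₁-formula (closed-form (+ u)))
    where
    closed-form : ∀ v → + 2 ℤ.* ℤ.- (+ 2 ℤ.+ v) ℤ.* (ℤ.- (+ 2 ℤ.+ v) ℤ.- + 1) ≡ + 2 ℤ.* (+ 2 ℤ.+ v) ℤ.* (+ 3 ℤ.+ v)
    closed-form = ℤ-Solver.solve-∀

  K₀≡2[a+e]e : K₀ ≡ 2 * (a + e) * e
  K₀≡2[a+e]e = +-injective (trans K₀-formula (closed-form (+ u)))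
    where
    closed-form : ∀ v → + 2 ℤ.* (+ 2 ℤ.* ℤ.- (+ 2 ℤ.+ v) ℤ.- + 1) ℤ.* (ℤ.- (+ 2 ℤ.+ v) ℤ.- + 1)
                        ≡ + 2 ℤ.* ((+ 2 ℤ.+ v) ℤ.+ (+ 3 ℤ.+ v)) ℤ.* (+ 3 ℤ.+ v)
    closed-form = ℤ-Solver.solve-∀

  1+L≡[1+u][2+u] : suc L ≡ (1 + u) * suc (1 + u)
  1+L≡[1+u][2+u] = identity u
    where
    identity : ∀ (u : ℕ) → 1 + ((1 + u) * (1 + u) + u) ≡ (1 + u) * (2 + u)
    identity = solve-∀

  l⊥2 : Coprime l 2
  l⊥2 = subst (λ i → Coprime i 2) (sym l≡L) (proj₁ (coprime-to-factors-of-suc {n = 1 + u} 1+L≡[1+u][2+u]))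
  l⊥a : Coprime l a
  l⊥a = subst (λ i → Coprime i a) (sym l≡L) (proj₂ (proj₂ (coprime-to-factors-of-suc {n = 1 + u} 1+L≡[1+u][2+u])))
  l⊥e : Coprime l e
  l⊥e = subst (λ i → Coprime i e) (sym l≡L) (Coprime.sym (Bézout⇒coprime u 1 (bezout u)))
    where
    bezout : ∀ (u : ℕ) → (3 + u) * u + 1 ≡ ((1 + u) * (1 + u) + u) * 1
    bezout = solve-∀
  l⊥a+e : Coprime l (a + e)
  l⊥a+e = subst (λ i → Coprime i (a + e)) (sym l≡L) (Bézout⇒coprime 4 (1 + 2 * u) (bezout u))
    where
    bezout : ∀ (u : ℕ) → ((1 + u) * (1 + u) + u) * 4 + 1 ≡ ((2 + u) + (3 + u)) * (1 + 2 * u)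
    bezout = solve-∀

  l≤1+K₁ : l ≤ suc K₁
  l≤1+K₁ = subst₂ _≤_ (sym l≡L) (trans (gap u) (cong suc (sym K₁≡2ae))) (m≤m+n L ((3 + u) * (4 + u)))
    where
    gap : ∀ (u : ℕ) → (1 + u) * (1 + u) + u + (3 + u) * (4 + u) ≡ 1 + 2 * (2 + u) * (3 + u)
    gap = solve-∀

  m<1+K₁ : m < suc K₁
  m<1+K₁ = subst₂ _<_ (sym (+-injective hm)) (trans (gap u) (cong suc (sym K₁≡2ae))) (s≤s (m≤m+n (a * a) ((2 + u) * (4 + u))))
    where
    gap : ∀ (u : ℕ) → 1 + ((2 + u) * (2 + u) + (2 + u) * (4 + u)) ≡ 1 + 2 * (2 + u) * (3 + u)
    gap = solve-∀

sameOrbit-1 : (σ : Permutation′ N) {x y : Fin N} → sameOrbit 1 σ x y ≡ true → x ≡ y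
sameOrbit-1 σ {x} {y} x≈y with x ≟ y
... | yes x≡y = x≡y
... | no _ with () ← x≈y

-- Besides strong regularity and the parameters, only the edge inside an orbit of σ is used, to
-- exclude s = 1 (where n = 1).
proposition6p2 :
    (n k l m : ℕ) (Γ : Graph (3 * n)) →
    IsSRG Γ k l m → NonTrivial Γ →
    (Prime n ⊎ Σ ℕ (λ d → ((+ d) ℤ.* (+ d) ≡ ((+ l) ℤ.- (+ m)) ℤ.* ((+ l) ℤ.- (+ m)) ℤ.+ (+ 4) ℤ.* ((+ k) ℤ.- (+ m))) × Coprime n (6 * d))) →
    (σ : Permutation′ (3 * n)) → IsAutomorphism Γ σ → IsSemiregular3 n σ →
    (Σ (Fin (3 * n)) λ x → Σ (Fin (3 * n)) λ y → (adj Γ x y ≡ true) × (sameOrbit n σ x y ≡ true)) →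
    edgesInOrbits Γ n σ ≤ edgesInOrbits (complement Γ) n σ →
    (s : ℤ) →
    (+ n) ≡ (+ 3) ℤ.* s ℤ.* s ℤ.- (+ 3) ℤ.* s ℤ.+ (+ 1) →
    (+ k) ≡ s ℤ.* ((+ 3) ℤ.* s ℤ.- (+ 1)) →
    (+ l) ≡ s ℤ.* s ℤ.+ s ℤ.- (+ 1) →
    (+ m) ≡ s ℤ.* s →
    ∀ x y → adj Γ x y ≡ true → ¬ ThreeIsoregular Γ x y
proposition6p2 n k l m Γ srg _ _ σ _ _ (x₀ , y₀ , x₀~y₀ , x₀≈y₀) _ s hn hk hl hm x y x~y (_ , iso) =
  excluded s (hn , hk , hl , hm)
  where
  counts : 0 < l → IsoregularEdgeCounts (3 * n) k l m
  counts = EdgeNeighbourhood.isoregular-edge-counts Γ srg x~y iso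

  excluded : ∀ s → InFamily s n k l m → ⊥
  excluded (+ 0)           (_ , _ , () , _)
  excluded (+ 1)           (hn , _) =
    adj⇒≢ Γ x₀~y₀ (sameOrbit-1 σ (subst (λ i → sameOrbit i σ x₀ y₀ ≡ true) (+-injective hn) x₀≈y₀))
  excluded (+ suc (suc u)) params = excluded-s≥2 u params counts
  excluded -[1+ 0 ]        (_ , _ , () , _)
  excluded -[1+ suc u ]    params = excluded-s≤-2 u params counts
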